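{- Let $H$ be a connected graph on $n$ vertices, and let $D$ be its $(n-1)$-graphlet degree distribution. For a vertex $v$ consider the property $$\sum_{i} D_{v,i}=n-1, \qquad (\dagger)$$ where the sum runs over all columns of $D$. Then $(\dagger)$ holds for zero vertices, for exactly one vertex, or for all vertices of $H$. These three cases occur exactly when $H$ has at least two cut vertices, exactly one cut vertex, and no cut vertex, respectively. Moreover, if $H$ has exactly one cut vertex, then this cut vertex is the unique vertex satisfying $(\dagger)$.
   Context: All graphs are finite, simple and undirected. A cut vertex (articulation) of a connected graph $H$ is a vertex $a$ such that $H-a$ is disconnected. A graphlet is a pair $(G,r)$ with $G$ a connected graph with at least one and fewer than $n$ vertices and $r\in V(G)$. Two graphlets are isomorphic if some isomorphism of the graphs maps root to root. For $v\in V(H)$, the graphlet degree of $v$ with respect to $(G,r)$ is the number of sets $S\subseteq V(H)$ with $v\in S$ such that some isomorphism $H[S]\to G$ maps $v$ to $r$. The $(n-1)$-graphlet degree distribution $D$ of $H$ is the matrix with rows indexed by the vertices of $H$ and columns by the graphlet classes with exactly $n-1$ vertices. Its entry $D_{v,i}$ is the graphlet degree of $v$ with respect to the $i$-th such class. -}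

module Defs where

open import Data.Nat using (ℕ; zero; suc; _∸_)
open import Data.Bool using (Bool; true; false)
import Data.Bool as B
open import Data.Fin using (Fin)
import Data.Fin as F
open import Data.Fin.Properties using (any?; all?)
open import Data.Fin.Subset using (Subset; _∈_; _∉_; ⊤; _-_; inside; outside)
open import Data.Fin.Subset.Properties using (_∈?_)
open import Data.Vec using (Vec; []; _∷_; lookup)
open import Data.List using (List; []; _∷_; _++_; map; length; filter; allFin)
open import Data.Nat.ListAction using (sum)
open import Data.Product using (Σ; ∃; _×_; _,_; proj₁; proj₂)
open import Relation.Nullary using (¬_; Dec; yes; no)
open import Relation.Nullary.Decidable using (_×-dec_; _→-dec_)
open import Relation.Binary.PropositionalEquality using (_≡_; _≢_)

record Graph (n : ℕ) : Set where
  field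
    adj    : Fin n → Fin n → Bool
    sym    : ∀ i j → adj i j ≡ adj j i
    irrefl : ∀ i → adj i i ≡ false
open Graph public

data Walk {n} (H : Graph n) (S : Subset n) : Fin n → Fin n → Set where
  here : ∀ {u} → u ∈ S → Walk H S u u
  step : ∀ {u w x} → u ∈ S → adj H u w ≡ true → Walk H S w x → Walk H S u x

DisconnectedOn : ∀ {n} → Graph n → Subset n → Set
DisconnectedOn H S = Σ _ λ u → Σ _ λ w → u ∈ S × w ∈ S × ¬ Walk H S u w

Connected : ∀ {n} → Graph n → Set
Connected {n} H = Fin n × (∀ u w → Walk H ⊤ u w)

IsCutVertex : ∀ {n} → Graph n → Fin n → Set
IsCutVertex H a = DisconnectedOn H (⊤ - a)

record Graphlet (k : ℕ) : Set where
  constructor graphlet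
  field
    graph : Graph k
    root  : Fin k
open Graphlet public

record GraphletIso {k} (A B : Graphlet k) : Set where
  field
    to       : Fin k → Fin k
    from     : Fin k → Fin k
    from-to  : ∀ i → from (to i) ≡ i
    to-from  : ∀ j → to (from j) ≡ j
    adj-pres : ∀ i j → adj (graph A) i j ≡ adj (graph B) (to i) (to j)
    root-pres : to (root A) ≡ root B

-- An isomorphism H[S] → G sending v to r is encoded by its inverse
-- g : V(G) → S (a vector of vertices of H): g is injective with image S,
-- preserves and reflects adjacency, and sends r to v.

InducedIso : ∀ {n k} → Graph n → Subset n → Fin n → Graphlet k → Vec (Fin n) k → Set
InducedIso {n} {k} H S v Gr g =
  (∀ i j → lookup g i ≡ lookup g j → i ≡ j) ×
  (∀ j → lookup g j ∈ S) ×
  (∀ x → x ∈ S → ∃ λ j → lookup g j ≡ x) ×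
  (∀ i j → adj (graph Gr) i j ≡ adj H (lookup g i) (lookup g j)) ×
  lookup g (root Gr) ≡ v

∃Vec? : ∀ {n} k {P : Vec (Fin n) k → Set} → (∀ g → Dec (P g)) → Dec (∃ P)
∃Vec? zero P? with P? []
... | yes p = yes ([] , p)
... | no ¬p = no λ { ([] , p) → ¬p p }
∃Vec? (suc k) {P} P? with any? (λ i → ∃Vec? k {λ g → P (i ∷ g)} (λ g → P? (i ∷ g)))
... | yes (i , g , p) = yes (i ∷ g , p)
... | no ¬q = no λ { (i ∷ g , p) → ¬q (i , g , p) }

inducedIso? : ∀ {n k} (H : Graph n) S v (Gr : Graphlet k) g → Dec (InducedIso H S v Gr g)
inducedIso? H S v Gr g =
  all? (λ i → all? (λ j → (lookup g i F.≟ lookup g j) →-dec (i F.≟ j))) ×-dec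
  (all? (λ j → lookup g j ∈? S) ×-dec
  (all? (λ x → (x ∈? S) →-dec any? (λ j → lookup g j F.≟ x)) ×-dec
  (all? (λ i → all? (λ j → adj (graph Gr) i j B.≟ adj H (lookup g i) (lookup g j))) ×-dec
  (lookup g (root Gr) F.≟ v))))

Counted : ∀ {n k} → Graph n → Fin n → Graphlet k → Subset n → Set
Counted {n} {k} H v Gr S = v ∈ S × ∃ λ (g : Vec (Fin n) k) → InducedIso H S v Gr g

counted? : ∀ {n k} (H : Graph n) v (Gr : Graphlet k) S → Dec (Counted H v Gr S)
counted? {n} {k} H v Gr S = (v ∈? S) ×-dec ∃Vec? k (inducedIso? H S v Gr)

allSubsets : ∀ n → List (Subset n)
allSubsets zero = [] ∷ []
allSubsets (suc n) = map (inside ∷_) (allSubsets n) ++ map (outside ∷_) (allSubsets n)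

graphletDegree : ∀ {n k} → Graph n → Fin n → Graphlet k → ℕ
graphletDegree H v Gr = length (filter (counted? H v Gr) (allSubsets _))

-- Columns of the (n-1)-graphlet degree distribution: a complete system
-- of pairwise non-isomorphic representatives of the isomorphism classes
-- of graphlets (connected rooted graphs) with exactly k = n - 1 vertices.

record GraphletClasses (k : ℕ) : Set where
  field
    m        : ℕ
    rep      : Fin m → Graphlet k
    rep-conn : ∀ i → Connected (graph (rep i))
    complete : ∀ (Gr : Graphlet k) → Connected (graph Gr) → ∃ λ i → GraphletIso Gr (rep i)
    distinct : ∀ i j → GraphletIso (rep i) (rep j) → i ≡ j
open GraphletClasses public

D : ∀ {n} (H : Graph n) (c : GraphletClasses (n ∸ 1)) → Fin n → Fin (m c) → ℕ
D H c v i = graphletDegree H v (rep c i)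

rowSum : ∀ {n} → Graph n → GraphletClasses (n ∸ 1) → Fin n → ℕ
rowSum H c v = sum (map (D H c v) (allFin (m c)))

Dagger : ∀ {n} → Graph n → GraphletClasses (n ∸ 1) → Fin n → Set
Dagger {n} H c v = rowSum H c v ≡ n ∸ 1

NoVertex : ∀ {n} → (Fin n → Set) → Set
NoVertex P = ∀ v → ¬ P v

ExactlyOne : ∀ {n} → (Fin n → Set) → Set
ExactlyOne P = ∃ λ v → P v × (∀ w → P w → w ≡ v)

AllVertices : ∀ {n} → (Fin n → Set) → Set
AllVertices P = ∀ v → P v

AtLeastTwo : ∀ {n} → (Fin n → Set) → Set
AtLeastTwo P = Σ _ λ u → Σ _ λ w → u ≢ w × P u × P w

-- If S is counted at v by a graphlet on n - 1 vertices, then |S| = n - 1, so S = V(H) - u for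
-- some u ≠ v, and H - u is connected because the graphlet is. Conversely, if H - u is connected,
-- then (H - u, v) is a connected graphlet and exactly one class, its own, is counted at V(H) - u.
-- So the row sum at v is the number of vertices u ≠ v that are not cut vertices: (†) holds at v
-- iff no vertex other than v is a cut vertex, and the three cases follow by counting cut vertices.
module Submission where

open import Defs hiding (sym)
open import Data.Nat using (ℕ; zero; suc; pred; _+_; _≤_; _<_; _∸_; z≤n; s≤s)
open import Data.Nat.Properties
  using (+-0-commutativeMonoid; +-comm; +-identityʳ; +-mono-≤; <⇒≢; <-irrefl)
open import Algebra.Properties.CommutativeMonoid.Sum +-0-commutativeMonoid
  using (sum-syntax; sum-remove; sum-cong-≗; sum-replicate-zero; ∑-comm)
open import Data.Bool using (true)
import Data.Bool as Bool
open import Data.Fin using (Fin; zero; suc; punchIn; punchOut; _≟_)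
open import Data.Fin.Properties
  using (any?; suc-injective; injective⇒≤; punchIn-injective; punchInᵢ≢i; punchIn-punchOut;
         punchOut-injective)
open import Data.Fin.Subset using (Subset; _∈_; _⊆_; _⊂_; ⊤; _-_; ⁅_⁆; inside; outside)
open import Data.Fin.Subset.Properties
  using (_∈?_; ∈⊤; ⊆-antisym; p─⊥≡p; p─q⊆p; x∈p∧x≢y⇒x∈p-y; x∈p⇒p-x⊂p)
open import Data.Fin.Subset.Induction using (Acc; acc; ⊂-wellFounded)
open import Data.Vec using (Vec; _∷_; lookup; tabulate; there)
open import Data.Vec.Properties using (lookup∘tabulate; ∷-injectiveˡ; ∷-injectiveʳ)
open import Data.List using ([]; _∷_; map; length; filter; allFin)
import Data.List as List
open import Data.List.Properties using (map-++; map-∘; map-tabulate)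
open import Data.Nat.ListAction using (sum)
open import Data.Nat.ListAction.Properties using (sum-++)
open import Data.Product using (Σ; ∃; _×_; _,_; proj₁; proj₂)
open import Data.Sum using (_⊎_; inj₁; inj₂)
open import Function using (_∘_; id)
open import Function.Bundles using (_⇔_; mk⇔; Equivalence)
open import Function.Definitions using (Injective)
open import Relation.Nullary using (¬_; Dec; yes; no; contradiction)
open import Relation.Nullary.Decidable using (_×-dec_; ¬?; map′; decidable-stable)
open import Relation.Unary using (Decidable)
open import Relation.Binary.PropositionalEquality

open Equivalence using (to; from)

indicator : ∀ {P : Set} → Dec P → ℕ
indicator (yes _) = 1
indicator (no _)  = 0

indicator-yes : ∀ {P : Set} (P? : Dec P) → P → indicator P? ≡ 1
indicator-yes (yes _) _  = refl
indicator-yes (no ¬p) p = contradiction p ¬p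

indicator-no : ∀ {P : Set} (P? : Dec P) → ¬ P → indicator P? ≡ 0
indicator-no (yes p) ¬p = contradiction p ¬p
indicator-no (no _)  _  = refl

indicator≤1 : ∀ {P : Set} (P? : Dec P) → indicator P? ≤ 1
indicator≤1 (yes _) = s≤s z≤n
indicator≤1 (no _)  = z≤n

count : ∀ {n} {P : Fin n → Set} → Decidable P → ℕ
count {n} P? = ∑[ i < n ] indicator (P? i)

count-none : ∀ {n} {P : Fin n → Set} (P? : Decidable P) → (∀ i → ¬ P i) → count P? ≡ 0
count-none {n} P? ¬P = trans (sum-cong-≗ (λ i → indicator-no (P? i) (¬P i))) (sum-replicate-zero n)

count-remove : ∀ {n} {P : Fin (suc n) → Set} (P? : Decidable P) i →
  count P? ≡ indicator (P? i) + count (P? ∘ punchIn i)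
count-remove P? i = sum-remove (indicator ∘ P?)

count-unique : ∀ {n} {P : Fin n → Set} (P? : Decidable P) i → P i → (∀ j → P j → j ≡ i) → count P? ≡ 1
count-unique {suc n} {P} P? i Pi unique = begin
  count P?                                   ≡⟨ count-remove P? i ⟩
  indicator (P? i) + count (P? ∘ punchIn i)  ≡⟨ cong₂ _+_ (indicator-yes (P? i) Pi) (count-none _ ¬other) ⟩
  1                                          ∎
  where
  open ≡-Reasoning
  ¬other : ∀ j → ¬ P (punchIn i j)
  ¬other j = punchInᵢ≢i i j ∘ unique (punchIn i j)

count≤n : ∀ {n} {P : Fin n → Set} (P? : Decidable P) → count P? ≤ n
count≤n {zero}  P? = z≤n
count≤n {suc n} P? = +-mono-≤ (indicator≤1 (P? zero)) (count≤n (P? ∘ suc))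

count≡n⇔all : ∀ {n} {P : Fin n → Set} (P? : Decidable P) → count P? ≡ n ⇔ (∀ i → P i)
count≡n⇔all P? = mk⇔ (count≡n⇒all P?) (all⇒count≡n P?)
  where
  count≡n⇒all : ∀ {n} {P : Fin n → Set} (P? : Decidable P) → count P? ≡ n → ∀ i → P i
  count≡n⇒all {suc n} P? eq i with P? zero
  count≡n⇒all {suc n} P? eq i       | no _ = contradiction eq (<⇒≢ (s≤s (count≤n (P? ∘ suc))))
  count≡n⇒all {suc n} P? eq zero    | yes P0 = P0
  count≡n⇒all {suc n} P? eq (suc i) | yes _ = count≡n⇒all (P? ∘ suc) (cong pred eq) i

  all⇒count≡n : ∀ {n} {P : Fin n → Set} (P? : Decidable P) → (∀ i → P i) → count P? ≡ n
  all⇒count≡n {zero}  P? _   = refl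
  all⇒count≡n {suc n} P? all =
    cong₂ _+_ (indicator-yes (P? zero) (all zero)) (all⇒count≡n (P? ∘ suc) (all ∘ suc))

count≡pred⇔allExcept : ∀ {n} {P : Fin (suc n) → Set} (P? : Decidable P) v → ¬ P v →
  count P? ≡ n ⇔ (∀ u → u ≢ v → P u)
count≡pred⇔allExcept {P = P} P? v ¬Pv = mk⇔
  (λ eq u u≢v → subst P (punchIn-punchOut (u≢v ∘ sym))
    (to (count≡n⇔all (P? ∘ punchIn v)) (trans (sym count-without-v) eq) (punchOut (u≢v ∘ sym))))
  (λ all → trans count-without-v
    (from (count≡n⇔all (P? ∘ punchIn v)) (λ j → all (punchIn v j) (punchInᵢ≢i v j))))
  where
  count-without-v : count P? ≡ count (P? ∘ punchIn v)
  count-without-v =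
    trans (count-remove P? v) (cong (_+ count (P? ∘ punchIn v)) (indicator-no (P? v) ¬Pv))

sum-tabulate : ∀ {n} (f : Fin n → ℕ) → sum (List.tabulate f) ≡ ∑[ i < n ] f i
sum-tabulate {zero}  f = refl
sum-tabulate {suc n} f = cong (f zero +_) (sum-tabulate (f ∘ suc))

sum-allFin : ∀ {n} (f : Fin n → ℕ) → sum (map f (allFin n)) ≡ ∑[ i < n ] f i
sum-allFin f = trans (cong sum (map-tabulate id f)) (sum-tabulate f)

length-filter≡sum-indicator : ∀ {A : Set} {P : A → Set} (P? : Decidable P) xs →
  length (filter P? xs) ≡ sum (map (indicator ∘ P?) xs)
length-filter≡sum-indicator P? []       = refl
length-filter≡sum-indicator P? (x ∷ xs) with P? x
... | yes _ = cong suc (length-filter≡sum-indicator P? xs)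
... | no _  = length-filter≡sum-indicator P? xs

sum-map-zero : ∀ {A : Set} {f : A → ℕ} xs → (∀ x → f x ≡ 0) → sum (map f xs) ≡ 0
sum-map-zero []       _  = refl
sum-map-zero (x ∷ xs) f0 = cong₂ _+_ (f0 x) (sum-map-zero xs f0)

sum-allSubsets-suc : ∀ {n} (G : Subset (suc n) → ℕ) →
  sum (map G (allSubsets (suc n))) ≡
  sum (map (G ∘ (inside ∷_)) (allSubsets n)) + sum (map (G ∘ (outside ∷_)) (allSubsets n))
sum-allSubsets-suc {n} G = begin
  sum (map G (map (inside ∷_) A List.++ map (outside ∷_) A))
    ≡⟨ cong sum (map-++ G (map (inside ∷_) A) _) ⟩
  sum (map G (map (inside ∷_) A) List.++ map G (map (outside ∷_) A))
    ≡⟨ sum-++ (map G (map (inside ∷_) A)) _ ⟩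
  sum (map G (map (inside ∷_) A)) + sum (map G (map (outside ∷_) A))
    ≡⟨ sym (cong₂ _+_ (cong sum (map-∘ A)) (cong sum (map-∘ A))) ⟩
  sum (map (G ∘ (inside ∷_)) A) + sum (map (G ∘ (outside ∷_)) A) ∎
  where
  open ≡-Reasoning
  A = allSubsets n

sum-allSubsets-only⊤ : ∀ {n} (G : Subset n → ℕ) → (∀ S → S ≢ ⊤ → G S ≡ 0) →
  sum (map G (allSubsets n)) ≡ G ⊤
sum-allSubsets-only⊤ {zero}  G _  = +-identityʳ _
sum-allSubsets-only⊤ {suc n} G G0 = begin
  sum (map G (allSubsets (suc n)))                                   ≡⟨ sum-allSubsets-suc G ⟩
  sum (map (G ∘ (inside ∷_)) A) + sum (map (G ∘ (outside ∷_)) A)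
    ≡⟨ cong₂ _+_ (sum-allSubsets-only⊤ _ (λ S S≢⊤ → G0 _ (S≢⊤ ∘ ∷-injectiveʳ)))
                 (sum-map-zero A (λ S → G0 _ λ ())) ⟩
  G ⊤ + 0                                                            ≡⟨ +-identityʳ _ ⟩
  G ⊤                                                                ∎
  where
  open ≡-Reasoning
  A = allSubsets n

⊤-zero : ∀ {n} → ⊤ - zero ≡ outside ∷ ⊤ {n}
⊤-zero = cong (outside ∷_) (p─⊥≡p ⊤)

sum-allSubsets-coSingletons : ∀ {n} (G : Subset n → ℕ) → (∀ S → (∀ u → S ≢ ⊤ - u) → G S ≡ 0) →
  sum (map G (allSubsets n)) ≡ ∑[ u < n ] G (⊤ - u)
sum-allSubsets-coSingletons {zero}  G G0 = trans (+-identityʳ _) (G0 _ λ ())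
sum-allSubsets-coSingletons {suc n} G G0 = begin
  sum (map G (allSubsets (suc n)))                                   ≡⟨ sum-allSubsets-suc G ⟩
  sum (map (G ∘ (inside ∷_)) A) + sum (map (G ∘ (outside ∷_)) A)
    ≡⟨ cong₂ _+_ (sum-allSubsets-coSingletons _ G0-inside) (sum-allSubsets-only⊤ _ G0-outside) ⟩
  ∑G′ + G (outside ∷ ⊤)     ≡⟨ +-comm ∑G′ _ ⟩
  G (outside ∷ ⊤) + ∑G′     ≡⟨ cong (λ S → G S + ∑G′) (sym ⊤-zero) ⟩
  ∑[ u < suc n ] G (⊤ - u)  ∎
  where
  open ≡-Reasoning
  A = allSubsets n
  ∑G′ = ∑[ u < n ] G (⊤ - suc u)
  inside≢outside : inside ≢ outside
  inside≢outside ()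
  G0-inside : ∀ S → (∀ u → S ≢ ⊤ - u) → G (inside ∷ S) ≡ 0
  G0-inside S S≢ = G0 _ λ where
    zero    eq → inside≢outside (∷-injectiveˡ (trans eq ⊤-zero))
    (suc u) eq → S≢ u (∷-injectiveʳ eq)
  G0-outside : ∀ S → S ≢ ⊤ → G (outside ∷ S) ≡ 0
  G0-outside S S≢⊤ = G0 _ λ where
    zero    eq → S≢⊤ (∷-injectiveʳ (trans eq ⊤-zero))
    (suc u) ()

x∈p-y⇒x≢y : ∀ {n} {p : Subset n} {x y : Fin n} → x ∈ p - y → x ≢ y
x∈p-y⇒x≢y {p = _ ∷ _} {zero}  {zero}  ()
x∈p-y⇒x≢y {p = _ ∷ _} {zero}  {suc _} _ ()
x∈p-y⇒x≢y {p = _ ∷ _} {suc _} {zero}  _ ()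
x∈p-y⇒x≢y {p = _ ∷ _} {suc _} {suc _} (there x∈) = x∈p-y⇒x≢y x∈ ∘ suc-injective

injective-avoiding⇒< : ∀ {m n} {f : Fin m → Fin n} → Injective _≡_ _≡_ f →
  ∀ {y} → (∀ i → f i ≢ y) → m < n
injective-avoiding⇒< {n = suc n} {f} f-inj {y} f≢y = s≤s (injective⇒≤ f′-inj)
  where
  f′ : _ → Fin n
  f′ i = punchOut (f≢y i ∘ sym)
  f′-inj : Injective _≡_ _≡_ f′
  f′-inj {i} {j} eq = f-inj (punchOut-injective (f≢y i ∘ sym) (f≢y j ∘ sym) eq)

injective-avoiding₂⇒< : ∀ {m n} {f : Fin m → Fin (suc n)} → Injective _≡_ _≡_ f →
  ∀ {y z} → y ≢ z → (∀ i → f i ≢ y) → (∀ i → f i ≢ z) → m < n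
injective-avoiding₂⇒< {f = f} f-inj {y} y≢z f≢y f≢z = injective-avoiding⇒< f′-inj f′≢z′
  where
  f′ : _ → _
  f′ i = punchOut (f≢y i ∘ sym)
  f′-inj : Injective _≡_ _≡_ f′
  f′-inj {i} {j} eq = f-inj (punchOut-injective (f≢y i ∘ sym) (f≢y j ∘ sym) eq)
  f′≢z′ : ∀ i → f′ i ≢ punchOut y≢z
  f′≢z′ i eq = f≢z i (punchOut-injective (f≢y i ∘ sym) y≢z eq)

module _ {n} {H : Graph n} where

  walk-source : ∀ {S x y} → Walk H S x y → x ∈ S
  walk-source (here x∈S)     = x∈S
  walk-source (step x∈S _ _) = x∈S

  walk-mono : ∀ {S T x y} → S ⊆ T → Walk H S x y → Walk H T x y
  walk-mono S⊆T (here x∈S)      = here (S⊆T x∈S)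
  walk-mono S⊆T (step x∈S xw r) = step (S⊆T x∈S) xw (walk-mono S⊆T r)

  -- Split a walk at its last visit to x.
  walk-avoiding⊎fromNeighbour : ∀ {S x y z} → Walk H S z y → y ≢ x →
    Walk H (S - x) z y ⊎ ∃ λ w → adj H x w ≡ true × Walk H (S - x) w y
  walk-avoiding⊎fromNeighbour (here y∈S) y≢x = inj₁ (here (x∈p∧x≢y⇒x∈p-y y∈S y≢x))
  walk-avoiding⊎fromNeighbour {x = x} (step {u = z} {w = w} z∈S zw r) y≢x
    with walk-avoiding⊎fromNeighbour r y≢x | z ≟ x
  ... | inj₂ later | _        = inj₂ later
  ... | inj₁ r′    | yes refl = inj₂ (w , zw , r′)
  ... | inj₁ r′    | no z≢x   = inj₁ (step (x∈p∧x≢y⇒x∈p-y z∈S z≢x) zw r′)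

walk? : ∀ {n} (H : Graph n) S x y → Dec (Walk H S x y)
walk? H S = go S (⊂-wellFounded S)
  where
  go : ∀ S → Acc _⊂_ S → ∀ x y → Dec (Walk H S x y)
  go S (acc rs) x y with x ∈? S | x ≟ y
  ... | no x∉S  | _        = no (x∉S ∘ walk-source)
  ... | yes x∈S | yes refl = yes (here x∈S)
  ... | yes x∈S | no x≢y   = map′ viaNeighbour toNeighbour
        (any? λ w → (adj H x w Bool.≟ true) ×-dec go (S - x) (rs (x∈p⇒p-x⊂p x∈S)) w y)
    where
    viaNeighbour : (∃ λ w → adj H x w ≡ true × Walk H (S - x) w y) → Walk H S x y
    viaNeighbour (w , xw , r) = step x∈S xw (walk-mono (p─q⊆p S ⁅ x ⁆) r)
    toNeighbour : Walk H S x y → ∃ λ w → adj H x w ≡ true × Walk H (S - x) w y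
    toNeighbour r with walk-avoiding⊎fromNeighbour r (x≢y ∘ sym)
    ... | inj₁ r′ = contradiction refl (x∈p-y⇒x≢y (walk-source r′))
    ... | inj₂ e  = e

ConnectedOn : ∀ {n} → Graph n → Subset n → Set
ConnectedOn H S = ∀ {x y} → x ∈ S → y ∈ S → Walk H S x y

disconnectedOn? : ∀ {n} (H : Graph n) S → Dec (DisconnectedOn H S)
disconnectedOn? H S = any? λ x → any? λ y → (x ∈? S) ×-dec (y ∈? S) ×-dec ¬? (walk? H S x y)

¬disconnectedOn⇒connectedOn : ∀ {n} {H : Graph n} {S} → ¬ DisconnectedOn H S → ConnectedOn H S
¬disconnectedOn⇒connectedOn {H = H} {S} ¬dis {x} {y} x∈S y∈S =
  decidable-stable (walk? H S x y) λ ¬w → ¬dis (x , y , x∈S , y∈S , ¬w)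

isCutVertex? : ∀ {n} (H : Graph n) → Decidable (IsCutVertex H)
isCutVertex? H u = disconnectedOn? H (⊤ - u)

cutVertex⇒otherVertex : ∀ {n} {H : Graph n} {u} → IsCutVertex H u → ∃ λ x → x ≢ u
cutVertex⇒otherVertex (x , _ , x∈ , _) = x , x∈p-y⇒x≢y x∈

inducedIso-tabulate : ∀ {n k} {H : Graph n} {S : Subset n} {v : Fin n} {Gr : Graphlet k}
  (e : Fin k → Fin n) → Injective _≡_ _≡_ e → (∀ j → e j ∈ S) → (∀ x → x ∈ S → ∃ λ j → e j ≡ x) →
  (∀ i j → adj (graph Gr) i j ≡ adj H (e i) (e j)) → e (root Gr) ≡ v →
  InducedIso H S v Gr (tabulate e)
inducedIso-tabulate {H = H} {S} e e-inj e∈S e-onto e-adj e-root =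
  (λ i j eq → e-inj (trans (sym (L i)) (trans eq (L j)))) ,
  (λ j → subst (_∈ S) (sym (L j)) (e∈S j)) ,
  (λ x x∈S → let (j , ej≡x) = e-onto x x∈S in j , trans (L j) ej≡x) ,
  (λ i j → trans (e-adj i j) (sym (cong₂ (adj H) (L i) (L j)))) ,
  trans (L _) e-root
  where
  L : ∀ j → lookup (tabulate e) j ≡ e j
  L = lookup∘tabulate e

module InducedIsoProperties {n k} {H : Graph n} {S : Subset n} {v : Fin n} {Gr : Graphlet k}
  {g : Vec (Fin n) k} (iso : InducedIso H S v Gr g) where

  private
    g-inj : ∀ i j → lookup g i ≡ lookup g j → i ≡ j
    g-inj = proj₁ iso
    g∈S : ∀ j → lookup g j ∈ S
    g∈S = proj₁ (proj₂ iso)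
    g-onto : ∀ x → x ∈ S → ∃ λ j → lookup g j ≡ x
    g-onto = proj₁ (proj₂ (proj₂ iso))
    g-adj : ∀ i j → adj (graph Gr) i j ≡ adj H (lookup g i) (lookup g j)
    g-adj = proj₁ (proj₂ (proj₂ (proj₂ iso)))
    g-root : lookup g (root Gr) ≡ v
    g-root = proj₂ (proj₂ (proj₂ (proj₂ iso)))

  toGraphletIso : ∀ {B : Graphlet k} {g′} → InducedIso H S v B g′ → GraphletIso Gr B
  toGraphletIso {g′ = g′} (g′-inj , g′∈S , g′-onto , g′-adj , g′-root) = record
    { to        = to′
    ; from      = from′
    ; from-to   = λ a → g-inj _ _ (trans (g∘from′ (to′ a)) (g′∘to′ a))
    ; to-from   = λ b → g′-inj _ _ (trans (g′∘to′ (from′ b)) (g∘from′ b))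
    ; adj-pres  = λ a b → trans (g-adj a b)
        (trans (sym (cong₂ (adj H) (g′∘to′ a) (g′∘to′ b))) (sym (g′-adj (to′ a) (to′ b))))
    ; root-pres = g′-inj _ _ (trans (g′∘to′ (root Gr)) (trans g-root (sym g′-root)))
    }
    where
    to′ : Fin k → Fin k
    to′ a = proj₁ (g′-onto (lookup g a) (g∈S a))
    g′∘to′ : ∀ a → lookup g′ (to′ a) ≡ lookup g a
    g′∘to′ a = proj₂ (g′-onto (lookup g a) (g∈S a))
    from′ : Fin k → Fin k
    from′ b = proj₁ (g-onto (lookup g′ b) (g′∈S b))
    g∘from′ : ∀ b → lookup g (from′ b) ≡ lookup g′ b
    g∘from′ b = proj₂ (g-onto (lookup g′ b) (g′∈S b))

  transport : ∀ {B} (φ : GraphletIso Gr B) → InducedIso H S v B (tabulate (lookup g ∘ GraphletIso.from φ))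
  transport {B} φ = inducedIso-tabulate {H = H} {S} {v} {B} (lookup g ∘ from′)
    (λ {i} {j} eq → trans (sym (to-from i)) (trans (cong to′ (g-inj _ _ eq)) (to-from j)))
    (g∈S ∘ from′)
    (λ x x∈S → let (j , gj≡x) = g-onto x x∈S in to′ j , trans (cong (lookup g) (from-to j)) gj≡x)
    (λ i j → trans (sym (cong₂ (adj (graph B)) (to-from i) (to-from j)))
      (trans (sym (adj-pres (from′ i) (from′ j))) (g-adj (from′ i) (from′ j))))
    (trans (cong (lookup g) (trans (sym (cong from′ root-pres)) (from-to (root Gr)))) g-root)
    where
    open GraphletIso φ renaming (to to to′; from to from′)

  walk-push : ∀ {a b} → Walk (graph Gr) ⊤ a b → Walk H S (lookup g a) (lookup g b)
  walk-push (here _)                          = here (g∈S _)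
  walk-push (step {u = a} {w = w} _ aw r) = step (g∈S a) (trans (sym (g-adj a w)) aw) (walk-push r)

  walk-pull : ∀ {x y} → Walk H S x y → ∀ {a b} → lookup g a ≡ x → lookup g b ≡ y → Walk (graph Gr) ⊤ a b
  walk-pull (here _) ga≡x gb≡x = subst (Walk _ ⊤ _) (g-inj _ _ (trans ga≡x (sym gb≡x))) (here ∈⊤)
  walk-pull (step {w = w} _ xw r) {a} ga≡x gb≡y =
    step ∈⊤ (trans (g-adj a c) (trans (cong₂ (adj H) ga≡x gc≡w) xw)) (walk-pull r gc≡w gb≡y)
    where
    c : Fin k
    c = proj₁ (g-onto w (walk-source r))
    gc≡w : lookup g c ≡ w
    gc≡w = proj₂ (g-onto w (walk-source r))

  connected⇔connectedOn : Connected (graph Gr) ⇔ ConnectedOn H S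
  connected⇔connectedOn = mk⇔
    (λ (_ , conn) {x} {y} x∈S y∈S →
      let (a , ga≡x) = g-onto x x∈S
          (b , gb≡y) = g-onto y y∈S
      in subst₂ (Walk H S) ga≡x gb≡y (walk-push (conn a b)))
    (λ conn → root Gr , λ a b → walk-pull (conn (g∈S a) (g∈S b)) refl refl)

inducedIso⇒coSingleton : ∀ {k} {H : Graph (suc k)} {S v} {Gr : Graphlet k} {g} →
  InducedIso H S v Gr g → ∃ λ u → S ≡ ⊤ - u
inducedIso⇒coSingleton {k} {S = S} {g = g} (inj , mem , onto , _) with any? (λ x → ¬? (x ∈? S))
... | no ¬missing = contradiction (injective⇒≤ pre-inj) (<-irrefl refl)
  where
  all∈S : ∀ x → x ∈ S
  all∈S x = decidable-stable (x ∈? S) λ x∉S → ¬missing (x , x∉S)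
  pre : Fin (suc k) → Fin k
  pre x = proj₁ (onto x (all∈S x))
  pre-inj : Injective _≡_ _≡_ pre
  pre-inj {x} {y} eq =
    trans (sym (proj₂ (onto x (all∈S x)))) (trans (cong (lookup g) eq) (proj₂ (onto y (all∈S y))))
... | yes (u , u∉S) = u , ⊆-antisym S⊆⊤-u ⊤-u⊆S
  where
  ≢u : ∀ {x} → x ∈ S → x ≢ u
  ≢u x∈S x≡u = u∉S (subst (_∈ S) x≡u x∈S)
  S⊆⊤-u : S ⊆ ⊤ - u
  S⊆⊤-u x∈S = x∈p∧x≢y⇒x∈p-y ∈⊤ (≢u x∈S)
  ⊤-u⊆S : ⊤ - u ⊆ S
  ⊤-u⊆S {x} x∈ = decidable-stable (x ∈? S) λ x∉S →
    <-irrefl refl (injective-avoiding₂⇒< (λ {i} {j} → inj i j) (x∈p-y⇒x≢y x∈ ∘ sym)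
      (λ j → ≢u (mem j)) (λ j gj≡x → x∉S (subst (_∈ S) gj≡x (mem j))))

removeVertex : ∀ {k} → Graph (suc k) → Fin (suc k) → Graph k
removeVertex H u = record
  { adj    = λ a b → adj H (punchIn u a) (punchIn u b)
  ; sym    = λ a b → Graph.sym H (punchIn u a) (punchIn u b)
  ; irrefl = λ a → irrefl H (punchIn u a)
  }

removeVertex-inducedIso : ∀ {k} (H : Graph (suc k)) {u v} (u≢v : u ≢ v) →
  InducedIso H (⊤ - u) v (graphlet (removeVertex H u) (punchOut u≢v)) (tabulate (punchIn u))
removeVertex-inducedIso H {u} {v} u≢v =
  inducedIso-tabulate {H = H} {⊤ - u} {v} {graphlet (removeVertex H u) (punchOut u≢v)} (punchIn u)
  (punchIn-injective u _ _)
  (λ j → x∈p∧x≢y⇒x∈p-y ∈⊤ (punchInᵢ≢i u j))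
  (λ x x∈ → let u≢x = x∈p-y⇒x≢y x∈ ∘ sym in punchOut u≢x , punchIn-punchOut u≢x)
  (λ _ _ → refl)
  (punchIn-punchOut u≢v)

counted-unique : ∀ {n k} {H : Graph n} {v S} (c : GraphletClasses k) {i j} →
  Counted H v (rep c i) S → Counted H v (rep c j) S → i ≡ j
counted-unique {H = H} {v} {S} c {i} {j} (_ , gᵢ , isoᵢ) (_ , gⱼ , isoⱼ) =
  distinct c i j (toGraphletIso {B = rep c j} {gⱼ} isoⱼ)
  where open InducedIsoProperties {H = H} {S} {v} {rep c i} {gᵢ} isoᵢ

module _ {k} (H : Graph (suc k)) (c : GraphletClasses k) where

  OtherNonCut : Fin (suc k) → Fin (suc k) → Set
  OtherNonCut v u = u ≢ v × ¬ IsCutVertex H u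

  otherNonCut? : ∀ v → Decidable (OtherNonCut v)
  otherNonCut? v u = ¬? (u ≟ v) ×-dec ¬? (isCutVertex? H u)

  counted⇒otherNonCut : ∀ {v u i} → Counted H v (rep c i) (⊤ - u) → OtherNonCut v u
  counted⇒otherNonCut {v} {u} {i} (v∈ , g , iso) =
    x∈p-y⇒x≢y v∈ ∘ sym , λ (_ , _ , x∈ , y∈ , ¬walk) → ¬walk (H-u-connected x∈ y∈)
    where
    open InducedIsoProperties {H = H} {⊤ - u} {v} {rep c i} {g} iso
    H-u-connected : ConnectedOn H (⊤ - u)
    H-u-connected = to connected⇔connectedOn (rep-conn c i)

  otherNonCut⇒counted : ∀ {v u} → OtherNonCut v u → ∃ λ i → Counted H v (rep c i) (⊤ - u)
  otherNonCut⇒counted {v} {u} (u≢v , ¬cut) =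
    i , x∈p∧x≢y⇒x∈p-y ∈⊤ (u≢v ∘ sym) , tabulate (lookup (tabulate (punchIn u)) ∘ GraphletIso.from φ) ,
    H-u.transport φ
    where
    H-u : Graphlet k
    H-u = graphlet (removeVertex H u) (punchOut u≢v)
    module H-u = InducedIsoProperties {H = H} {⊤ - u} {v} {H-u} {tabulate (punchIn u)}
      (removeVertex-inducedIso H u≢v)
    H-u-connected : Connected (graph H-u)
    H-u-connected = from H-u.connected⇔connectedOn (¬disconnectedOn⇒connectedOn ¬cut)
    i = proj₁ (complete c H-u H-u-connected)
    φ = proj₂ (complete c H-u H-u-connected)

  classCount-coSingleton : ∀ v u →
    ∑[ i < m c ] indicator (counted? H v (rep c i) (⊤ - u)) ≡ indicator (otherNonCut? v u)
  classCount-coSingleton v u with otherNonCut? v u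
  ... | yes good = let (i , countedᵢ) = otherNonCut⇒counted good in
        count-unique (λ i → counted? H v (rep c i) (⊤ - u)) i countedᵢ
          (λ j countedⱼ → counted-unique {H = H} {v} {⊤ - u} c countedⱼ countedᵢ)
  ... | no ¬good =
        count-none (λ i → counted? H v (rep c i) (⊤ - u)) (λ i → ¬good ∘ counted⇒otherNonCut)

  graphletDegree≡∑ : ∀ v (Gr : Graphlet k) →
    graphletDegree H v Gr ≡ ∑[ u < suc k ] indicator (counted? H v Gr (⊤ - u))
  graphletDegree≡∑ v Gr = trans (length-filter≡sum-indicator (counted? H v Gr) (allSubsets _))
    (sum-allSubsets-coSingletons _ λ S S≢ → indicator-no (counted? H v Gr S)
      λ (_ , g , iso) → let (u , S≡⊤-u) = inducedIso⇒coSingleton {H = H} {S} {v} {Gr} {g} iso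
                        in S≢ u S≡⊤-u)

  rowSum≡count : ∀ v → rowSum H c v ≡ count (otherNonCut? v)
  rowSum≡count v = begin
    sum (map (D H c v) (allFin (m c)))          ≡⟨ sum-allFin (D H c v) ⟩
    ∑[ i < m c ] graphletDegree H v (rep c i)   ≡⟨ sum-cong-≗ (graphletDegree≡∑ v ∘ rep c) ⟩
    ∑[ i < m c ] ∑[ u < suc k ] χ i u           ≡⟨ ∑-comm χ ⟩
    ∑[ u < suc k ] ∑[ i < m c ] χ i u           ≡⟨ sum-cong-≗ (classCount-coSingleton v) ⟩
    count (otherNonCut? v)                      ∎
    where
    open ≡-Reasoning
    χ : Fin (m c) → Fin (suc k) → ℕ
    χ i u = indicator (counted? H v (rep c i) (⊤ - u))

  dagger⇔noOtherCutVertex : ∀ v → Dagger H c v ⇔ (∀ u → u ≢ v → ¬ IsCutVertex H u)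
  dagger⇔noOtherCutVertex v = mk⇔
    (λ dagger u u≢v → proj₂ (to counting (trans (sym (rowSum≡count v)) dagger) u u≢v))
    (λ noCut → trans (rowSum≡count v) (from counting λ u u≢v → u≢v , noCut u u≢v))
    where
    counting = count≡pred⇔allExcept (otherNonCut? v) v (λ (v≢v , _) → v≢v refl)

noVertex⊎exactlyOne⊎atLeastTwo : ∀ {n} {C : Fin n → Set} → Decidable C →
  NoVertex C ⊎ ExactlyOne C ⊎ AtLeastTwo C
noVertex⊎exactlyOne⊎atLeastTwo C? with any? C?
... | no ¬some = inj₁ λ v Cv → ¬some (v , Cv)
... | yes (a , Ca) with any? (λ b → ¬? (b ≟ a) ×-dec C? b)
...   | yes (b , b≢a , Cb) = inj₂ (inj₂ (a , b , b≢a ∘ sym , Ca , Cb))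
...   | no ¬other =
        inj₂ (inj₁ (a , Ca , λ b Cb → decidable-stable (b ≟ a) λ b≢a → ¬other (b , b≢a , Cb)))

twoDistinct : ∀ {n} → 2 ≤ n → Σ (Fin n) λ a → Σ (Fin n) λ b → a ≢ b
twoDistinct (s≤s (s≤s _)) = zero , suc zero , λ ()

module SoleException {n} {C P : Fin n → Set} (C? : Decidable C)
  (P⇔ : ∀ v → P v ⇔ (∀ u → u ≢ v → ¬ C u)) where

  noC⇒allP : NoVertex C → AllVertices P
  noC⇒allP noC v = from (P⇔ v) λ u _ → noC u

  uniqueC⇒uniqueP : ∀ a → C a → (∀ b → C b → b ≡ a) → P a × (∀ v → P v → v ≡ a)
  uniqueC⇒uniqueP a Ca unique =
    from (P⇔ a) (λ u u≢a Cu → u≢a (unique u Cu)) ,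
    λ v Pv → decidable-stable (v ≟ a) λ v≢a → to (P⇔ v) Pv a (v≢a ∘ sym) Ca

  twoC⇒noP : AtLeastTwo C → NoVertex P
  twoC⇒noP (a , b , a≢b , Ca , Cb) v Pv with a ≟ v
  ... | yes refl = to (P⇔ a) Pv b (a≢b ∘ sym) Cb
  ... | no a≢v   = to (P⇔ v) Pv a a≢v Ca

  classify : NoVertex P ⊎ ExactlyOne P ⊎ AllVertices P
  classify with noVertex⊎exactlyOne⊎atLeastTwo C?
  ... | inj₁ noC                  = inj₂ (inj₂ (noC⇒allP noC))
  ... | inj₂ (inj₁ (a , Ca , u))  = inj₂ (inj₁ (a , uniqueC⇒uniqueP a Ca u))
  ... | inj₂ (inj₂ twoC)          = inj₁ (twoC⇒noP twoC)

  noP⇔twoC : Fin n → NoVertex P ⇔ AtLeastTwo C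
  noP⇔twoC v = mk⇔ noP⇒twoC twoC⇒noP
    where
    noP⇒twoC : NoVertex P → AtLeastTwo C
    noP⇒twoC noP with noVertex⊎exactlyOne⊎atLeastTwo C?
    ... | inj₁ noC                 = contradiction (noC⇒allP noC v) (noP v)
    ... | inj₂ (inj₁ (a , Ca , u)) = contradiction (proj₁ (uniqueC⇒uniqueP a Ca u)) (noP a)
    ... | inj₂ (inj₂ twoC)         = twoC

  oneP⇔oneC : Σ (Fin n) (λ a → Σ (Fin n) λ b → a ≢ b) → ExactlyOne P ⇔ ExactlyOne C
  oneP⇔oneC (a , b , a≢b) = mk⇔ oneP⇒oneC λ (c , Cc , u) → c , uniqueC⇒uniqueP c Cc u
    where
    oneP⇒oneC : ExactlyOne P → ExactlyOne C
    oneP⇒oneC (v , Pv , unique) with noVertex⊎exactlyOne⊎atLeastTwo C?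
    ... | inj₁ noC         =
          contradiction (trans (unique a (noC⇒allP noC a)) (sym (unique b (noC⇒allP noC b)))) a≢b
    ... | inj₂ (inj₁ oneC) = oneC
    ... | inj₂ (inj₂ twoC) = contradiction Pv (twoC⇒noP twoC v)

  allP⇔noC : (∀ u → C u → ∃ λ x → x ≢ u) → AllVertices P ⇔ NoVertex C
  allP⇔noC other = mk⇔
    (λ allP u Cu → let (x , x≢u) = other u Cu in to (P⇔ x) (allP x) u (x≢u ∘ sym) Cu)
    noC⇒allP

mainTheorem7 : (n : ℕ) (H : Graph n) → Connected H → (c : GraphletClasses (n ∸ 1)) →
    (NoVertex (Dagger H c) ⊎ ExactlyOne (Dagger H c) ⊎ AllVertices (Dagger H c)) ×
    (NoVertex (Dagger H c) ⇔ AtLeastTwo (IsCutVertex H)) ×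
    (2 ≤ n → (ExactlyOne (Dagger H c) ⇔ ExactlyOne (IsCutVertex H))) ×
    (AllVertices (Dagger H c) ⇔ NoVertex (IsCutVertex H)) ×
    ((a : Fin n) → IsCutVertex H a → (∀ b → IsCutVertex H b → b ≡ a) →
      Dagger H c a × (∀ v → Dagger H c v → v ≡ a))
mainTheorem7 zero    H (() , _) c
mainTheorem7 (suc k) H (v₀ , _) c =
  classify ,
  noP⇔twoC v₀ ,
  (λ 2≤n → oneP⇔oneC (twoDistinct 2≤n)) ,
  allP⇔noC (λ _ → cutVertex⇒otherVertex) ,
  uniqueC⇒uniqueP
  where open SoleException (isCutVertex? H) (dagger⇔noOtherCutVertex H c)
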